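{- Let $n\ge 2$ and for $w\in S_n$ define $V_0(w)=v\in\mathbb{Z}^T$ by $v_{ij}=-\gamma_{ij}(w)+\sum_{i\le k<j}\gamma_{k,k+1}(w)$ for $1\le i<j\le n$. Then each $V_0(w)$ is an admitted vector; $V_0(w)=V_0(w')$ whenever $w,w'$ are conjugate words; and $N(w)=\sum_{1\le i<j\le n}V_0(w)_{ij}$.
   Context: Permutations $w\in S_n$ are viewed as words on $\{1,\ldots,n\}$; conjugate words are $xy$ and $yx$. For $i<j$, $\gamma_{ij}(w)=1$ if $j$ appears before $i$ in $w$ and $0$ otherwise. $N(w)=\sum_{k=1}^{n-1}k(n-k)\gamma_{k,k+1}(w)-\sum_{1\le i<j\le n}\gamma_{ij}(w)$. Let $T=\{(i,j):1\le i<j\le n\}$ and write $v_{ij}=v_{(i,j)}$. A vector $v\in\mathbb{N}^T$ ($\mathbb N$ the nonnegative integers) is admitted if $v_{i,i+1}=0$ for all $1\le i<n$ and $v_{ij}+v_{jk}\le v_{ik}\le v_{ij}+v_{jk}+1$ for all $1\le i<j<k\le n$. -}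

module Defs where

open import Data.Bool using (Bool; true; false; if_then_else_)
open import Data.Nat using (ℕ; zero; suc; _∸_; _≡ᵇ_)
open import Data.Integer using (ℤ; +_; _+_; _-_; _*_)
open import Data.List using (List; []; _∷_; applyUpTo)
open import Data.List.Relation.Binary.Permutation.Propositional using (_↭_)
open import Data.List using (_++_)
open import Data.Product using (∃₂; _×_)
open import Relation.Binary.PropositionalEquality using (_≡_)
import Data.Nat as ℕ
import Data.Integer as ℤ

IsPerm : ℕ → List ℕ → Set
IsPerm n w = w ↭ applyUpTo suc n

appearsBefore : ℕ → ℕ → List ℕ → Bool
appearsBefore j i []      = false
appearsBefore j i (x ∷ w) with x ≡ᵇ j | x ≡ᵇ i
... | true  | _     = true
... | false | true  = false
... | false | false = appearsBefore j i w

γ : List ℕ → ℕ → ℕ → ℤ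
γ w i j = if appearsBefore j i w then + 1 else + 0

sumFrom : ℕ → ℕ → (ℕ → ℤ) → ℤ
sumFrom a zero    f = + 0
sumFrom a (suc l) f = f a + sumFrom (suc a) l f

sumPairs : ℕ → (ℕ → ℕ → ℤ) → ℤ
sumPairs n f = sumFrom 1 n (λ i → sumFrom (suc i) (n ∸ i) (λ j → f i j))

N : ℕ → List ℕ → ℤ
N n w = sumFrom 1 (n ∸ 1) (λ k → (+ k * + (n ∸ k)) * γ w k (suc k))
        - sumPairs n (γ w)

-- V_0(w)_{ij} = −γ_{ij}(w) + ∑_{i ≤ k < j} γ_{k,k+1}(w)
-- (a vector in ℤ^T, represented as a function; only entries 1 ≤ i < j ≤ n matter)
V₀ : List ℕ → ℕ → ℕ → ℤ
V₀ w i j = sumFrom i (j ∸ i) (λ k → γ w k (suc k)) - γ w i j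

Conjugate : List ℕ → List ℕ → Set
Conjugate w w' = ∃₂ λ x y → (w ≡ x ++ y) × (w' ≡ y ++ x)

Admitted : ℕ → (ℕ → ℕ → ℤ) → Set
Admitted n v =
  (∀ i j → 1 ℕ.≤ i → i ℕ.< j → j ℕ.≤ n → + 0 ℤ.≤ v i j)
  × (∀ i → 1 ℕ.≤ i → i ℕ.< n → v i (suc i) ≡ + 0)
  × (∀ i j k → 1 ℕ.≤ i → i ℕ.< j → j ℕ.< k → k ℕ.≤ n →
       (v i j + v j k ℤ.≤ v i k) × (v i k ℤ.≤ v i j + v j k + + 1))

{-# OPTIONS --safe #-}
-- For any f : ℕ → ℕ → ℤ put V f i j = ∑_{i ≤ k < j} f k (k+1) − f i j.  Splitting the sum
-- at j gives V f i k − V f i j − V f j k = f i j + f j k − f i k, so the admissibility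
-- inequalities say exactly that this defect is 0 or 1, and nonnegativity follows from them
-- by induction on j − i.  For f = γ w the defect is [q < p] + [r < q] − [r < p] for the
-- positions p, q, r of i, j, k in w, which is 0 or 1 by transitivity of <.  Rotating
-- w = xy to yx adds to γ the coboundary of the indicator of x, which the telescoping sum
-- in V cancels; only this step needs w to be a permutation.  Finally
-- ∑_{i<j} ∑_{i ≤ k < j} h k = ∑_k k (n − k) h k, as k lies in exactly k (n − k) intervals.
module Submission where

open import Data.Bool using (Bool; true; false; if_then_else_)
open import Data.Empty using (⊥-elim)
open import Data.Integer as ℤ using (ℤ; +_; _+_; _-_; _*_; +≤+)
import Data.Integer.Properties as ℤₚ
open import Data.Integer.Tactic.RingSolver using (solve-∀)
open import Data.List using (List; []; _∷_; _++_)
open import Data.List.Membership.Propositional using (_∈_; _∉_)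
open import Data.List.Membership.Propositional.Properties using (∈-++⁺ʳ; ∈-++⁻; ∈-applyUpTo⁺)
open import Data.List.Relation.Binary.Permutation.Propositional using (↭-sym; ↭⇒↭ₛ)
open import Data.List.Relation.Binary.Permutation.Propositional.Properties using (∈-resp-↭)
import Data.List.Relation.Unary.All as All
open import Data.List.Relation.Unary.AllPairs using (_∷_)
open import Data.List.Relation.Unary.Any as Any using (here; there)
open import Data.List.Relation.Unary.Unique.Propositional using (Unique)
open import Data.List.Relation.Unary.Unique.Propositional.Properties using (applyUpTo⁺₁)
open import Data.Nat as ℕ using (ℕ; zero; suc; _∸_; _≤_; _<_; _≤′_; ≤′-refl; ≤′-step; _<ᵇ_; _≡ᵇ_; z≤n; s≤s)
import Data.Nat.Properties as ℕₚ
open import Data.List.Membership.DecPropositional ℕₚ._≟_ using (_∈?_)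
open import Data.Product using (_×_; _,_; proj₁)
open import Data.Sum as Sum using (_⊎_; inj₁; inj₂)
open import Function using (_∘_; id)
open import Relation.Binary.PropositionalEquality
open import Data.List.Relation.Binary.Permutation.Setoid.Properties (setoid ℕ) using (Unique-resp-↭)
open import Relation.Nullary using (yes; no; does)
open import Relation.Nullary.Reflects using (Reflects; ofʸ; ofⁿ; fromEquivalence)

open import Defs

sumRange : ℕ → ℕ → (ℕ → ℤ) → ℤ
sumRange i j h = sumFrom i (j ∸ i) h

sumFrom-cong : ∀ a L {f g : ℕ → ℤ} → (∀ k → a ≤ k → k < a ℕ.+ L → f k ≡ g k) →
               sumFrom a L f ≡ sumFrom a L g
sumFrom-cong a zero    f≗g = refl
sumFrom-cong a (suc L) f≗g =
  cong₂ _+_ (f≗g a ℕₚ.≤-refl (ℕₚ.m<m+n a (s≤s z≤n)))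
            (sumFrom-cong (suc a) L λ k a<k k<1+a+L →
               f≗g k (ℕₚ.<⇒≤ a<k) (subst (k <_) (sym (ℕₚ.+-suc a L)) k<1+a+L))

sumFrom-snoc : ∀ a L (h : ℕ → ℤ) → sumFrom a (suc L) h ≡ sumFrom a L h + h (a ℕ.+ L)
sumFrom-snoc a zero    h rewrite ℕₚ.+-identityʳ a =
  trans (ℤₚ.+-identityʳ (h a)) (sym (ℤₚ.+-identityˡ (h a)))
sumFrom-snoc a (suc L) h rewrite ℕₚ.+-suc a L =
  trans (cong (_+_ (h a)) (sumFrom-snoc (suc a) L h)) (sym (ℤₚ.+-assoc (h a) _ _))

sumFrom-++ : ∀ a L M (h : ℕ → ℤ) → sumFrom a (L ℕ.+ M) h ≡ sumFrom a L h + sumFrom (a ℕ.+ L) M h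
sumFrom-++ a zero    M h rewrite ℕₚ.+-identityʳ a = sym (ℤₚ.+-identityˡ _)
sumFrom-++ a (suc L) M h rewrite ℕₚ.+-suc a L =
  trans (cong (_+_ (h a)) (sumFrom-++ (suc a) L M h)) (sym (ℤₚ.+-assoc (h a) _ _))

sumFrom-+ : ∀ a L (f g : ℕ → ℤ) → sumFrom a L (λ k → f k + g k) ≡ sumFrom a L f + sumFrom a L g
sumFrom-+ a zero    f g = refl
sumFrom-+ a (suc L) f g =
  trans (cong (_+_ (f a + g a)) (sumFrom-+ (suc a) L f g)) (interchange (f a) (g a) _ _)
  where
  interchange : ∀ x y u v → (x + y) + (u + v) ≡ (x + u) + (y + v)
  interchange = solve-∀

sumFrom-- : ∀ a L (f g : ℕ → ℤ) → sumFrom a L (λ k → f k - g k) ≡ sumFrom a L f - sumFrom a L g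
sumFrom-- a zero    f g = refl
sumFrom-- a (suc L) f g =
  trans (cong (_+_ (f a - g a)) (sumFrom-- (suc a) L f g)) (interchange (f a) (g a) _ _)
  where
  interchange : ∀ x y u v → (x - y) + (u - v) ≡ (x + u) - (y + v)
  interchange = solve-∀

sumFrom-const : ∀ a L (c : ℤ) → sumFrom a L (λ _ → c) ≡ + L * c
sumFrom-const a zero    c = sym (ℤₚ.*-zeroˡ c)
sumFrom-const a (suc L) c = trans (cong (_+_ c) (sumFrom-const (suc a) L c)) (distrib c (+ L))
  where
  distrib : ∀ x l → x + l * x ≡ (+ 1 + l) * x
  distrib = solve-∀

sumFrom-telescope : ∀ a L (h s : ℕ → ℤ) →
  sumFrom a L (λ k → h k + s k - s (suc k)) ≡ sumFrom a L h + s a - s (a ℕ.+ L)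
sumFrom-telescope a zero    h s rewrite ℕₚ.+-identityʳ a = cancel (s a)
  where
  cancel : ∀ x → + 0 ≡ + 0 + x - x
  cancel = solve-∀
sumFrom-telescope a (suc L) h s rewrite ℕₚ.+-suc a L =
  trans (cong (_+_ (h a + s a - s (suc a))) (sumFrom-telescope (suc a) L h s))
        (cancel (h a) (s a) (s (suc a)) _ _)
  where
  cancel : ∀ x y z S t → (x + y - z) + (S + z - t) ≡ (x + S) + y - t
  cancel = solve-∀

sumRange-empty : ∀ i (h : ℕ → ℤ) → sumRange i i h ≡ + 0
sumRange-empty i h rewrite ℕₚ.n∸n≡0 i = refl

sumRange-cong : ∀ {i j} {f g : ℕ → ℤ} → i ≤ j → (∀ k → i ≤ k → k < j → f k ≡ g k) →
                sumRange i j f ≡ sumRange i j g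
sumRange-cong {i} i≤j f≗g with a , refl ← ℕₚ.m≤n⇒∃[o]m+o≡n i≤j rewrite ℕₚ.m+n∸m≡n i a =
  sumFrom-cong i a f≗g

sumRange-snoc : ∀ {i j} (h : ℕ → ℤ) → i ≤ j → sumRange i (suc j) h ≡ sumRange i j h + h j
sumRange-snoc {i} h i≤j with a , refl ← ℕₚ.m≤n⇒∃[o]m+o≡n i≤j
  rewrite ℕₚ.+-∸-assoc 1 (ℕₚ.m≤m+n i a) | ℕₚ.m+n∸m≡n i a = sumFrom-snoc i a h

sumRange-split : ∀ {i j k} (h : ℕ → ℤ) → i ≤ j → j ≤ k →
                 sumRange i k h ≡ sumRange i j h + sumRange j k h
sumRange-split {i} h i≤j j≤k
  with a , refl ← ℕₚ.m≤n⇒∃[o]m+o≡n i≤j | b , refl ← ℕₚ.m≤n⇒∃[o]m+o≡n j≤k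
  rewrite ℕₚ.m+n∸m≡n (i ℕ.+ a) b | ℕₚ.+-assoc i a b | ℕₚ.m+n∸m≡n i (a ℕ.+ b) | ℕₚ.m+n∸m≡n i a =
  sumFrom-++ i a b h

sumRange-telescope : ∀ {i j} (h s : ℕ → ℤ) → i ≤ j →
  sumRange i j (λ k → h k + s k - s (suc k)) ≡ sumRange i j h + s i - s j
sumRange-telescope {i} h s i≤j with a , refl ← ℕₚ.m≤n⇒∃[o]m+o≡n i≤j rewrite ℕₚ.m+n∸m≡n i a =
  sumFrom-telescope i a h s

IsBit : ℤ → Set
IsBit d = d ≡ + 0 ⊎ d ≡ + 1

IsBit⇒bounds : ∀ v {d} → IsBit d → (v ℤ.≤ v + d) × (v + d ℤ.≤ v + + 1)
IsBit⇒bounds v (inj₁ refl) = ℤₚ.i≤i+j v (+ 0) , ℤₚ.+-monoʳ-≤ v (+≤+ z≤n)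
IsBit⇒bounds v (inj₂ refl) = ℤₚ.i≤i+j v (+ 1) , ℤₚ.≤-refl

V : (ℕ → ℕ → ℤ) → ℕ → ℕ → ℤ
V f i j = sumRange i j (λ k → f k (suc k)) - f i j

defect : (ℕ → ℕ → ℤ) → ℕ → ℕ → ℕ → ℤ
defect f i j k = f i j + f j k - f i k

HasBitDefects : (ℕ → ℕ → ℤ) → Set
HasBitDefects f = ∀ {i j k} → i < j → j < k → IsBit (defect f i j k)

V-diag : ∀ f i → V f i (suc i) ≡ + 0
V-diag f i rewrite ℕₚ.m+n∸n≡m 1 i =
  trans (cong (_- f i (suc i)) (ℤₚ.+-identityʳ (f i (suc i)))) (ℤₚ.+-inverseʳ (f i (suc i)))

V-split : ∀ f {i j k} → i ≤ j → j ≤ k → V f i k ≡ V f i j + V f j k + defect f i j k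
V-split f {i} {j} {k} i≤j j≤k = begin
  S i k - f i k
    ≡⟨ cong (_- f i k) (sumRange-split _ i≤j j≤k) ⟩
  S i j + S j k - f i k
    ≡⟨ rearrange (S i j) (S j k) (f i j) (f j k) (f i k) ⟩
  (S i j - f i j) + (S j k - f j k) + (f i j + f j k - f i k) ∎
  where
  open ≡-Reasoning
  S : ℕ → ℕ → ℤ
  S a b = sumRange a b (λ c → f c (suc c))
  rearrange : ∀ s t x y z → s + t - z ≡ (s - x) + (t - y) + (x + y - z)
  rearrange = solve-∀

V-triangle : ∀ f → HasBitDefects f → ∀ {i j k} → i < j → j < k →
             (V f i j + V f j k ℤ.≤ V f i k) × (V f i k ℤ.≤ V f i j + V f j k + + 1)
V-triangle f bits {i} {j} {k} i<j j<k =
  subst (λ v → (V f i j + V f j k ℤ.≤ v) × (v ℤ.≤ V f i j + V f j k + + 1))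
        (sym (V-split f (ℕₚ.<⇒≤ i<j) (ℕₚ.<⇒≤ j<k)))
        (IsBit⇒bounds (V f i j + V f j k) (bits i<j j<k))

V-nonneg : ∀ f → HasBitDefects f → ∀ {i j} → i < j → + 0 ℤ.≤ V f i j
V-nonneg f bits {i} i<j = go (ℕₚ.≤⇒≤′ i<j)
  where
  go : ∀ {j} → suc i ≤′ j → + 0 ℤ.≤ V f i j
  go ≤′-refl             = ℤₚ.≤-reflexive (sym (V-diag f i))
  go (≤′-step {j} i<′j) = begin
    + 0                      ≤⟨ go i<′j ⟩
    V f i j                  ≡⟨ sym (ℤₚ.+-identityʳ (V f i j)) ⟩
    V f i j + + 0            ≡⟨ cong (_+_ (V f i j)) (sym (V-diag f j)) ⟩
    V f i j + V f j (suc j)  ≤⟨ proj₁ (V-triangle f bits (ℕₚ.≤′⇒≤ i<′j) (ℕₚ.n<1+n j)) ⟩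
    V f i (suc j)            ∎
    where open ℤₚ.≤-Reasoning

V-admitted : ∀ f → HasBitDefects f → ∀ n → Admitted n (V f)
V-admitted f bits n =
    (λ i j _ i<j _ → V-nonneg f bits i<j)
  , (λ i _ _ → V-diag f i)
  , (λ i j k _ i<j j<k _ → V-triangle f bits i<j j<k)

V-coboundary : ∀ f g (s : ℕ → ℤ) {i j} → i < j →
               (∀ {a b} → i ≤ a → a < b → b ≤ j → g a b ≡ f a b + s a - s b) →
               V g i j ≡ V f i j
V-coboundary f g s {i} {j} i<j g≡f+δs = begin
  sumRange i j (λ k → g k (suc k)) - g i j
    ≡⟨ cong₂ _-_ (sumRange-cong i≤j λ k i≤k k<j → g≡f+δs i≤k (ℕₚ.n<1+n k) k<j)
                 (g≡f+δs ℕₚ.≤-refl i<j ℕₚ.≤-refl) ⟩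
  sumRange i j (λ k → f k (suc k) + s k - s (suc k)) - (f i j + s i - s j)
    ≡⟨ cong (_- (f i j + s i - s j)) (sumRange-telescope (λ k → f k (suc k)) s i≤j) ⟩
  (S + s i - s j) - (f i j + s i - s j)
    ≡⟨ cancel S (f i j) (s i) (s j) ⟩
  S - f i j ∎
  where
  open ≡-Reasoning
  i≤j = ℕₚ.<⇒≤ i<j
  S = sumRange i j (λ k → f k (suc k))
  cancel : ∀ x y u v → (x + u - v) - (y + u - v) ≡ x - y
  cancel = solve-∀

𝟙 : Bool → ℤ
𝟙 b = if b then + 1 else + 0

position : ℕ → List ℕ → ℕ
position a []      = 0
position a (x ∷ w) = if x ≡ᵇ a then 0 else suc (position a w)

≡ᵇ-reflects-≡ : ∀ m n → Reflects (m ≡ n) (m ≡ᵇ n)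
≡ᵇ-reflects-≡ m n = fromEquivalence (ℕₚ.≡ᵇ⇒≡ m n) (ℕₚ.≡⇒≡ᵇ m n)

appearsBefore≡<ᵇ : ∀ {a b} w → a ≢ b → appearsBefore b a w ≡ (position b w <ᵇ position a w)
appearsBefore≡<ᵇ []      a≢b = refl
appearsBefore≡<ᵇ {a} {b} (x ∷ w) a≢b
  with x ≡ᵇ b | ≡ᵇ-reflects-≡ x b | x ≡ᵇ a | ≡ᵇ-reflects-≡ x a
... | true  | ofʸ refl | true  | ofʸ refl = ⊥-elim (a≢b refl)
... | true  | _        | false | _        = refl
... | false | _        | true  | _        = refl
... | false | _        | false | _        = appearsBefore≡<ᵇ w a≢b

<ᵇ-defect-isBit : ∀ p q r → IsBit (𝟙 (q <ᵇ p) + 𝟙 (r <ᵇ q) - 𝟙 (r <ᵇ p))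
<ᵇ-defect-isBit p q r
  with q <ᵇ p | ℕₚ.<ᵇ-reflects-< q p | r <ᵇ q | ℕₚ.<ᵇ-reflects-< r q | r <ᵇ p | ℕₚ.<ᵇ-reflects-< r p
... | true  | ofʸ q<p | true  | ofʸ r<q | false | ofⁿ r≮p = ⊥-elim (r≮p (ℕₚ.<-trans r<q q<p))
... | true  | _       | true  | _       | true  | _       = inj₂ refl
... | true  | _       | false | _       | false | _       = inj₂ refl
... | true  | _       | false | _       | true  | _       = inj₁ refl
... | false | _       | true  | _       | false | _       = inj₂ refl
... | false | _       | true  | _       | true  | _       = inj₁ refl
... | false | _       | false | _       | false | _       = inj₁ refl
... | false | ofⁿ q≮p | false | ofⁿ r≮q | true  | ofʸ r<p =
  ⊥-elim (ℕₚ.<⇒≱ r<p (ℕₚ.≤-trans (ℕₚ.≮⇒≥ q≮p) (ℕₚ.≮⇒≥ r≮q)))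

γ-hasBitDefects : ∀ w → HasBitDefects (γ w)
γ-hasBitDefects w {i} {j} {k} i<j j<k =
  subst IsBit (sym (cong₂ _-_ (cong₂ _+_ (pos i<j) (pos j<k)) (pos (ℕₚ.<-trans i<j j<k))))
        (<ᵇ-defect-isBit (position i w) (position j w) (position k w))
  where
  pos : ∀ {a b} → a < b → γ w a b ≡ 𝟙 (position b w <ᵇ position a w)
  pos a<b = cong 𝟙 (appearsBefore≡<ᵇ w (ℕₚ.<⇒≢ a<b))

appearsBefore-++ˡ : ∀ {b a} x y → b ∈ x ⊎ a ∈ x → appearsBefore b a (x ++ y) ≡ appearsBefore b a x
appearsBefore-++ˡ []      y (inj₁ ())
appearsBefore-++ˡ []      y (inj₂ ())
appearsBefore-++ˡ {b} {a} (z ∷ x) y b∈x⊎a∈x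
  with z ≡ᵇ b | ≡ᵇ-reflects-≡ z b | z ≡ᵇ a | ≡ᵇ-reflects-≡ z a
... | true  | _       | _     | _       = refl
... | false | _       | true  | _       = refl
... | false | ofⁿ z≢b | false | ofⁿ z≢a =
  appearsBefore-++ˡ x y (Sum.map (Any.tail (z≢b ∘ sym)) (Any.tail (z≢a ∘ sym)) b∈x⊎a∈x)

appearsBefore-++ʳ : ∀ {b a} x y → b ∉ x → a ∉ x → appearsBefore b a (x ++ y) ≡ appearsBefore b a y
appearsBefore-++ʳ []      y b∉x a∉x = refl
appearsBefore-++ʳ {b} {a} (z ∷ x) y b∉x a∉x
  with z ≡ᵇ b | ≡ᵇ-reflects-≡ z b | z ≡ᵇ a | ≡ᵇ-reflects-≡ z a
... | true  | ofʸ refl | _     | _        = ⊥-elim (b∉x (here refl))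
... | false | _        | true  | ofʸ refl = ⊥-elim (a∉x (here refl))
... | false | _        | false | _        = appearsBefore-++ʳ x y (b∉x ∘ there) (a∉x ∘ there)

appearsBefore-∈-∉ : ∀ {b a} x → b ∈ x → a ∉ x → appearsBefore b a x ≡ true
appearsBefore-∈-∉ {b} {a} (z ∷ x) b∈x a∉x
  with z ≡ᵇ b | ≡ᵇ-reflects-≡ z b | z ≡ᵇ a | ≡ᵇ-reflects-≡ z a
... | true  | _       | _     | _        = refl
... | false | _       | true  | ofʸ refl = ⊥-elim (a∉x (here refl))
... | false | ofⁿ z≢b | false | _        = appearsBefore-∈-∉ x (Any.tail (z≢b ∘ sym) b∈x) (a∉x ∘ there)

appearsBefore-∉-∈ : ∀ {b a} x → b ∉ x → a ∈ x → appearsBefore b a x ≡ false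
appearsBefore-∉-∈ {b} {a} (z ∷ x) b∉x a∈x
  with z ≡ᵇ b | ≡ᵇ-reflects-≡ z b | z ≡ᵇ a | ≡ᵇ-reflects-≡ z a
... | true  | ofʸ refl | _     | _       = ⊥-elim (b∉x (here refl))
... | false | _        | true  | _       = refl
... | false | _        | false | ofⁿ z≢a = appearsBefore-∉-∈ x (b∉x ∘ there) (Any.tail (z≢a ∘ sym) a∈x)

Unique-++⇒∉ʳ : ∀ {x y : List ℕ} {a} → Unique (x ++ y) → a ∈ x → a ∉ y
Unique-++⇒∉ʳ {z ∷ x} (z∉x++y ∷ _)  (here refl) a∈y = All.lookup z∉x++y (∈-++⁺ʳ x a∈y) refl
Unique-++⇒∉ʳ {z ∷ x} (_      ∷ x!) (there a∈x)     = Unique-++⇒∉ʳ x! a∈x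

∈-++-∉ˡ : ∀ {x y : List ℕ} {a} → a ∈ x ++ y → a ∉ x → a ∈ y
∈-++-∉ˡ {x} a∈x++y a∉x = Sum.[ ⊥-elim ∘ a∉x , id ]′ (∈-++⁻ x a∈x++y)

γ-rotate : ∀ {a b} x y → Unique (x ++ y) → a ∈ x ++ y → b ∈ x ++ y →
           γ (y ++ x) a b ≡ γ (x ++ y) a b + 𝟙 (does (a ∈? x)) - 𝟙 (does (b ∈? x))
γ-rotate {a} {b} x y x++y! a∈x++y b∈x++y with a ∈? x | b ∈? x
... | yes a∈x | yes b∈x
  rewrite appearsBefore-++ˡ {b} {a} x y (inj₁ b∈x)
        | appearsBefore-++ʳ y x (Unique-++⇒∉ʳ x++y! b∈x) (Unique-++⇒∉ʳ x++y! a∈x)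
  = sym (+1-1 (𝟙 (appearsBefore b a x)))
  where
  +1-1 : ∀ t → t + + 1 - + 1 ≡ t
  +1-1 = solve-∀
... | yes a∈x | no b∉x
  rewrite appearsBefore-++ˡ {b} {a} x y (inj₂ a∈x) | appearsBefore-∉-∈ x b∉x a∈x
        | appearsBefore-++ˡ {b} {a} y x (inj₁ (∈-++-∉ˡ b∈x++y b∉x))
        | appearsBefore-∈-∉ y (∈-++-∉ˡ b∈x++y b∉x) (Unique-++⇒∉ʳ x++y! a∈x)
  = refl
... | no a∉x | yes b∈x
  rewrite appearsBefore-++ˡ {b} {a} x y (inj₁ b∈x) | appearsBefore-∈-∉ x b∈x a∉x
        | appearsBefore-++ˡ {b} {a} y x (inj₂ (∈-++-∉ˡ a∈x++y a∉x))
        | appearsBefore-∉-∈ y (Unique-++⇒∉ʳ x++y! b∈x) (∈-++-∉ˡ a∈x++y a∉x)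
  = refl
... | no a∉x | no b∉x
  rewrite appearsBefore-++ʳ x y b∉x a∉x | appearsBefore-++ˡ {b} {a} y x (inj₁ (∈-++-∉ˡ b∈x++y b∉x))
  = sym (+0-0 (𝟙 (appearsBefore b a y)))
  where
  +0-0 : ∀ t → t + + 0 - + 0 ≡ t
  +0-0 = solve-∀

IsPerm⇒∈ : ∀ {n w a} → IsPerm n w → 1 ≤ a → a ≤ n → a ∈ w
IsPerm⇒∈ w↭ (s≤s z≤n) a≤n = ∈-resp-↭ (↭-sym w↭) (∈-applyUpTo⁺ suc a≤n)

IsPerm⇒Unique : ∀ {n w} → IsPerm n w → Unique w
IsPerm⇒Unique {n} w↭ = Unique-resp-↭ (↭⇒↭ₛ (↭-sym w↭))
  (applyUpTo⁺₁ suc n λ i<j _ → ℕₚ.<⇒≢ i<j ∘ ℕₚ.suc-injective)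

V₀-conjugate : ∀ {n w w' i j} → IsPerm n w → Conjugate w w' → 1 ≤ i → i < j → j ≤ n →
               V₀ w i j ≡ V₀ w' i j
V₀-conjugate {j = j} x++y↭ (x , y , refl , refl) 1≤i i<j j≤n =
  sym (V-coboundary (γ (x ++ y)) (γ (y ++ x)) (λ a → 𝟙 (does (a ∈? x))) i<j
         λ i≤a a<b b≤j → γ-rotate x y (IsPerm⇒Unique x++y↭)
                           (∈x++y (ℕₚ.≤-trans 1≤i i≤a) (ℕₚ.≤-trans (ℕₚ.<⇒≤ a<b) b≤j))
                           (∈x++y (ℕₚ.≤-trans 1≤i (ℕₚ.≤-trans i≤a (ℕₚ.<⇒≤ a<b))) b≤j))
  where
  ∈x++y : ∀ {a} → 1 ≤ a → a ≤ j → a ∈ x ++ y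
  ∈x++y 1≤a a≤j = IsPerm⇒∈ x++y↭ 1≤a (ℕₚ.≤-trans a≤j j≤n)

sumPairs-- : ∀ n (f g : ℕ → ℕ → ℤ) → sumPairs n (λ i j → f i j - g i j) ≡ sumPairs n f - sumPairs n g
sumPairs-- n f g =
  trans (sumFrom-cong 1 n λ i _ _ → sumFrom-- (suc i) (n ∸ i) (f i) (g i))
        (sumFrom-- 1 n _ _)

sumPairs-suc : ∀ n (f : ℕ → ℕ → ℤ) →
               sumPairs (suc n) f ≡ sumPairs n f + sumRange 1 (suc n) (λ i → f i (suc n))
sumPairs-suc n f = begin
  sumRange 1 (2 ℕ.+ n) (λ i → sumRange (suc i) (2 ℕ.+ n) (f i))
    ≡⟨ sumRange-snoc {j = suc n} _ (s≤s z≤n) ⟩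
  sumRange 1 (suc n) (λ i → sumRange (suc i) (2 ℕ.+ n) (f i)) + sumRange (2 ℕ.+ n) (2 ℕ.+ n) (f (suc n))
    ≡⟨ cong₂ _+_ (sumRange-cong {j = suc n} (s≤s z≤n) λ i _ i<1+n → sumRange-snoc (f i) i<1+n)
                 (sumRange-empty (2 ℕ.+ n) (f (suc n))) ⟩
  sumRange 1 (suc n) (λ i → sumRange (suc i) (suc n) (f i) + f i (suc n)) + + 0
    ≡⟨ ℤₚ.+-identityʳ _ ⟩
  sumRange 1 (suc n) (λ i → sumRange (suc i) (suc n) (f i) + f i (suc n))
    ≡⟨ sumFrom-+ 1 n _ _ ⟩
  sumPairs n f + sumRange 1 (suc n) (λ i → f i (suc n)) ∎
  where open ≡-Reasoning

sumRange-suffixes : ∀ n (h : ℕ → ℤ) →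
  sumRange 1 (suc n) (λ i → sumRange i (suc n) h) ≡ sumRange 1 (suc n) (λ k → + k * h k)
sumRange-suffixes zero    h = refl
sumRange-suffixes (suc n) h = begin
  sumRange 1 (2 ℕ.+ n) (λ i → sumRange i (2 ℕ.+ n) h)
    ≡⟨ sumRange-snoc {j = suc n} _ (s≤s z≤n) ⟩
  sumRange 1 (suc n) (λ i → sumRange i (2 ℕ.+ n) h) + sumRange (suc n) (2 ℕ.+ n) h
    ≡⟨ cong₂ _+_ (sumRange-cong {j = suc n} (s≤s z≤n) λ i _ i<1+n → sumRange-snoc h (ℕₚ.<⇒≤ i<1+n))
                 (sumRange-snoc {j = suc n} h ℕₚ.≤-refl) ⟩
  sumRange 1 (suc n) (λ i → sumRange i (suc n) h + h (suc n)) + (sumRange (suc n) (suc n) h + h (suc n))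
    ≡⟨ cong₂ _+_ (sumFrom-+ 1 n _ _) (cong (_+ h (suc n)) (sumRange-empty (suc n) h)) ⟩
  (sumRange 1 (suc n) (λ i → sumRange i (suc n) h) + sumRange 1 (suc n) (λ _ → h (suc n)))
    + (+ 0 + h (suc n))
    ≡⟨ cong₂ (λ s t → s + t + (+ 0 + h (suc n)))
             (sumRange-suffixes n h) (sumFrom-const 1 n (h (suc n))) ⟩
  D + + n * h (suc n) + (+ 0 + h (suc n))
    ≡⟨ collect D (+ n) (h (suc n)) ⟩
  D + + suc n * h (suc n)
    ≡⟨ sym (sumRange-snoc {j = suc n} _ (s≤s z≤n)) ⟩
  sumRange 1 (2 ℕ.+ n) (λ k → + k * h k) ∎
  where
  open ≡-Reasoning
  D = sumRange 1 (suc n) (λ k → + k * h k)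
  collect : ∀ d m x → d + m * x + (+ 0 + x) ≡ d + (+ 1 + m) * x
  collect = solve-∀

weightedSum : ℕ → (ℕ → ℤ) → ℤ
weightedSum n h = sumRange 1 n (λ k → + k * + (n ∸ k) * h k)

weightedSum-suc : ∀ n (h : ℕ → ℤ) →
                  weightedSum (suc n) h ≡ weightedSum n h + sumRange 1 (suc n) (λ k → + k * h k)
weightedSum-suc n h = begin
  sumRange 1 (suc n) (λ k → + k * + (suc n ∸ k) * h k)
    ≡⟨ sumRange-cong {j = suc n} (s≤s z≤n) (λ k _ k<1+n →
         trans (cong (λ m → + k * + m * h k) (ℕₚ.+-∸-assoc 1 (ℕₚ.≤-pred k<1+n)))
               (distrib (+ k) (+ (n ∸ k)) (h k))) ⟩
  sumRange 1 (suc n) (λ k → + k * + (n ∸ k) * h k + + k * h k)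
    ≡⟨ sumFrom-+ 1 n _ _ ⟩
  sumRange 1 (suc n) (λ k → + k * + (n ∸ k) * h k) + sumRange 1 (suc n) (λ k → + k * h k)
    ≡⟨ cong (_+ sumRange 1 (suc n) (λ k → + k * h k)) (dropTop n) ⟩
  weightedSum n h + sumRange 1 (suc n) (λ k → + k * h k) ∎
  where
  open ≡-Reasoning
  distrib : ∀ k m x → k * (+ 1 + m) * x ≡ k * m * x + k * x
  distrib = solve-∀
  dropTop : ∀ m → sumRange 1 (suc m) (λ k → + k * + (m ∸ k) * h k) ≡ weightedSum m h
  dropTop zero    = refl
  dropTop (suc m) rewrite sumRange-snoc (λ k → + k * + (suc m ∸ k) * h k) (s≤s (z≤n {m}))
                        | ℕₚ.n∸n≡0 m | ℤₚ.*-zeroʳ (+ suc m) | ℤₚ.*-zeroˡ (h (suc m)) =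
    ℤₚ.+-identityʳ _

sumPairs-sumRange : ∀ n (h : ℕ → ℤ) → sumPairs n (λ i j → sumRange i j h) ≡ weightedSum n h
sumPairs-sumRange zero    h = refl
sumPairs-sumRange (suc n) h = begin
  sumPairs (suc n) (λ i j → sumRange i j h)
    ≡⟨ sumPairs-suc n _ ⟩
  sumPairs n (λ i j → sumRange i j h) + sumRange 1 (suc n) (λ i → sumRange i (suc n) h)
    ≡⟨ cong₂ _+_ (sumPairs-sumRange n h) (sumRange-suffixes n h) ⟩
  weightedSum n h + sumRange 1 (suc n) (λ k → + k * h k)
    ≡⟨ sym (weightedSum-suc n h) ⟩
  weightedSum (suc n) h ∎
  where open ≡-Reasoning

sumPairs-V : ∀ n f → sumPairs n (V f) ≡ weightedSum n (λ k → f k (suc k)) - sumPairs n f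
sumPairs-V n f =
  trans (sumPairs-- n _ f) (cong (_- sumPairs n f) (sumPairs-sumRange n (λ k → f k (suc k))))

proposition3p1 : (n : ℕ) → 2 ≤ n →
    (∀ (w : List ℕ) → IsPerm n w → Admitted n (V₀ w))
    × (∀ (w w' : List ℕ) → IsPerm n w → IsPerm n w' → Conjugate w w' →
         ∀ i j → 1 ≤ i → i < j → j ≤ n → V₀ w i j ≡ V₀ w' i j)
    × (∀ (w : List ℕ) → IsPerm n w → N n w ≡ sumPairs n (V₀ w))
proposition3p1 n _ =
    (λ w _ → V-admitted (γ w) (γ-hasBitDefects w) n)
  , (λ w w' w-perm _ w~w' i j → V₀-conjugate w-perm w~w')
  , (λ w _ → sym (sumPairs-V n (γ w)))
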